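{- Let $M=(m_{ij})\in\mathbb{Z}^{d\times d}$ satisfy $m_{ii}=0$, $m_{ij}+m_{jk}\ge m_{ik}$ for all $i,j,k$, $M\ge0$, and $m_{ij}+m_{ji}>0$ for $i\ne j$. Let $N,N'\in\mathbb{Z}^{d\times d}$ both satisfy $$n_{ik}\le n_{ij}+m_{jk}\quad\text{and}\quad n_{ik}\le m_{ij}+n_{jk}\qquad\text{for all }1\le i,j,k\le d$$ (and likewise for $N'$). Then $I_N I_{N'}=I_{N\,\underline{\odot}\,N'}$, where $(N\,\underline{\odot}\,N')_{ij}=\min_k(n_{ik}+n'_{kj})$.
   Context: $K$ is a field with a surjective discrete valuation $\mathrm{val}:K\to\mathbb{Z}\cup\{\infty\}$, $p\in K$ with $\mathrm{val}(p)=1$, $\mathcal{O}_K$ its valuation ring. For $N\in\mathbb{Z}^{d\times d}$, $I_N=\{X\in K^{d\times d}:\mathrm{val}(x_{ij})\ge n_{ij}\ \forall i,j\}$; under the hypotheses, $I_N$ is a fractional ideal of the order $\Lambda_M=I_M$. The product $I_NI_{N'}$ is the additive subgroup of $K^{d\times d}$ generated by all products $XY$ with $X\in I_N$, $Y\in I_{N'}$. -}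

module Defs where

open import Level using (Level; _⊔_) renaming (suc to lsuc)
open import Algebra.Bundles using (CommutativeRing)
open import Data.Nat using (ℕ; zero; suc)
open import Data.Fin using (Fin; zero; suc)
open import Data.Integer as ℤ using (ℤ; +_; _⊓_)
open import Data.Maybe using (Maybe; just; nothing)
open import Data.Product using (Σ; _×_; ∃; _,_)
open import Data.Unit using (⊤)
open import Relation.Nullary using (¬_)
open import Relation.Binary.PropositionalEquality using (_≡_)
open import Function.Bundles using (_⇔_)

ℤ∞ : Set
ℤ∞ = Maybe ℤ

∞ : ℤ∞
∞ = nothing

_+∞_ : ℤ∞ → ℤ∞ → ℤ∞
just a +∞ just b = just (a ℤ.+ b)
_      +∞ _      = nothing

min∞ : ℤ∞ → ℤ∞ → ℤ∞
min∞ (just a) (just b) = just (a ⊓ b)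
min∞ (just a) nothing  = just a
min∞ nothing  y        = y

data _≤∞_ : ℤ∞ → ℤ∞ → Set where
  fin≤fin : ∀ {a b} → a ℤ.≤ b → just a ≤∞ just b
  _≤∞∞    : ∀ x → x ≤∞ nothing

record IsField {c ℓ} (R : CommutativeRing c ℓ) : Set (c ⊔ ℓ) where
  open CommutativeRing R hiding (zero)
  field
    1≉0     : ¬ (1# ≈ 0#)
    inverse : ∀ x → ¬ (x ≈ 0#) → Σ Carrier λ y → x * y ≈ 1#

record IsSurjDiscreteValuation {c ℓ} (R : CommutativeRing c ℓ)
       (val : CommutativeRing.Carrier R → ℤ∞) : Set (c ⊔ ℓ) where
  open CommutativeRing R hiding (zero)
  field
    val-cong : ∀ {x y} → x ≈ y → val x ≡ val y
    val-∞    : ∀ x → (val x ≡ ∞) ⇔ (x ≈ 0#)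
    val-*    : ∀ x y → val (x * y) ≡ val x +∞ val y
    val-+    : ∀ x y → min∞ (val x) (val y) ≤∞ val (x + y)
    val-surj : ∀ (n : ℤ) → Σ Carrier λ x → val x ≡ just n

IMat : ℕ → Set
IMat d = Fin d → Fin d → ℤ

minFin : ∀ {n} → (Fin (suc n) → ℤ) → ℤ
minFin {zero}  f = f zero
minFin {suc n} f = f zero ⊓ minFin (λ i → f (suc i))

_⊙_ : ∀ {n} → IMat (suc n) → IMat (suc n) → IMat (suc n)
(N ⊙ N′) i j = minFin (λ k → N i k ℤ.+ N′ k j)

module MatOver {c ℓ} (R : CommutativeRing c ℓ) where
  open CommutativeRing R hiding (zero)

  Mat : ℕ → Set c
  Mat d = Fin d → Fin d → Carrier

  _≈ₘ_ : ∀ {d} → Mat d → Mat d → Set ℓ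
  X ≈ₘ Y = ∀ i j → X i j ≈ Y i j

  Σ[_] : ∀ {d} → (Fin d → Carrier) → Carrier
  Σ[_] {zero}  f = 0#
  Σ[_] {suc d} f = f zero + Σ[ (λ i → f (suc i)) ]

  _*ₘ_ : ∀ {d} → Mat d → Mat d → Mat d
  (X *ₘ Y) i j = Σ[ (λ k → X i k * Y k j) ]

  _+ₘ_ : ∀ {d} → Mat d → Mat d → Mat d
  (X +ₘ Y) i j = X i j + Y i j

  -ₘ_ : ∀ {d} → Mat d → Mat d
  (-ₘ X) i j = - X i j

  0ₘ : ∀ {d} → Mat d
  0ₘ i j = 0#

  module WithVal (val : Carrier → ℤ∞) where

    _∈I_ : ∀ {d} → Mat d → IMat d → Set
    X ∈I N = ∀ i j → just (N i j) ≤∞ val (X i j)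

    data _∈I_·I_ {d} (Z : Mat d) (N N′ : IMat d) : Set (c ⊔ ℓ) where
      gen  : (X Y : Mat d) → X ∈I N → Y ∈I N′ → Z ≈ₘ (X *ₘ Y) → Z ∈I N ·I N′
      zro  : Z ≈ₘ 0ₘ → Z ∈I N ·I N′
      add  : (A B : Mat d) → A ∈I N ·I N′ → B ∈I N ·I N′ → Z ≈ₘ (A +ₘ B) → Z ∈I N ·I N′
      neg  : (A : Mat d) → A ∈I N ·I N′ → Z ≈ₘ (-ₘ A) → Z ∈I N ·I N′

IsOrderMatrix : ∀ {d} → IMat d → Set
IsOrderMatrix M =
    (∀ i → M i i ≡ + 0)
  × (∀ i j k → M i k ℤ.≤ M i j ℤ.+ M j k)
  × (∀ i j → + 0 ℤ.≤ M i j)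
  × (∀ i j → ¬ (i ≡ j) → + 0 ℤ.< M i j ℤ.+ M j i)

IsCompatible : ∀ {d} → IMat d → IMat d → Set
IsCompatible M N =
    (∀ i j k → N i k ℤ.≤ N i j ℤ.+ M j k)
  × (∀ i j k → N i k ℤ.≤ M i j ℤ.+ N j k)

{-# OPTIONS --safe #-}
module Submission where

-- Neither inclusion uses the hypotheses on M, N, N′ (they only make I_N a
-- fractional ideal of Λ_M) nor the uniformiser p; surjectivity of val suffices.
-- Entrywise val ((XY)_ij) ≥ min_k (n_ik + n′_kj), so the products, and hence the
-- group they generate, lie in I_{N ⊙ N′}.  Conversely Z ∈ I_{N ⊙ N′} is the sum
-- of the matrices z_ij E_ij, and if k attains the minimum and val a = n_ik then
-- z_ij E_ij = (a E_ik) (a⁻¹ z_ij E_kj) with a E_ik ∈ I_N and a⁻¹ z_ij E_kj ∈ I_N′.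

open import Defs
open import Algebra.Bundles using (CommutativeRing; AbelianGroup)
import Algebra.Properties.Group as GroupProperties
import Algebra.Properties.Ring as RingProperties
open import Data.Nat using (ℕ; zero; suc)
open import Data.Integer as ℤ using (ℤ; +_)
import Data.Integer.Properties as ℤ
open import Data.Maybe using (just; nothing)
open import Data.Maybe.Properties using (just-injective)
open import Data.Fin using (Fin; zero; suc)
open import Data.Fin.Properties using (_≟_; suc-injective)
open import Data.Product using (∃; _,_)
open import Data.Sum using (inj₁; inj₂)
open import Relation.Nullary using (¬_; Dec; yes; no; contradiction)
open import Function.Base using (_∘_)
import Relation.Binary.Reasoning.Setoid as ≈-Reasoning
open import Relation.Binary.PropositionalEquality as ≡ using (_≡_; refl)
open import Function.Bundles using (_⇔_; mk⇔; Equivalence)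

module ℤ-Group = GroupProperties (AbelianGroup.group ℤ.+-0-abelianGroup)

i+i≡i⇒i≡0 : ∀ i → i ℤ.+ i ≡ i → i ≡ + 0
i+i≡i⇒i≡0 i eq = ℤ-Group.∙-cancelˡ i i (+ 0) (≡.trans eq (≡.sym (ℤ.+-identityʳ i)))

i+i≡0⇒i≡0 : ∀ i → i ℤ.+ i ≡ + 0 → i ≡ + 0
i+i≡0⇒i≡0 i eq = ℤ.*-cancelˡ-≡ (+ 2) i (+ 0) (begin
    + 2 ℤ.* i                  ≡⟨ ℤ.*-distribʳ-+ i (+ 1) (+ 1) ⟩
    + 1 ℤ.* i ℤ.+ + 1 ℤ.* i    ≡⟨ ≡.cong₂ ℤ._+_ (ℤ.*-identityˡ i) (ℤ.*-identityˡ i) ⟩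
    i ℤ.+ i                    ≡⟨ eq ⟩
    + 0                        ∎)
  where open ≡.≡-Reasoning

≤∞-trans : ∀ {x y z} → x ≤∞ y → y ≤∞ z → x ≤∞ z
≤∞-trans (fin≤fin p) (fin≤fin q) = fin≤fin (ℤ.≤-trans p q)
≤∞-trans _           (_ ≤∞∞)     = _ ≤∞∞

≤∞-min∞ : ∀ {m x y} → just m ≤∞ x → just m ≤∞ y → just m ≤∞ min∞ x y
≤∞-min∞ (fin≤fin p) (fin≤fin q) = fin≤fin (ℤ.⊓-glb p q)
≤∞-min∞ (fin≤fin p) (_ ≤∞∞)     = fin≤fin p
≤∞-min∞ (_ ≤∞∞)     q           = q

+∞-mono-≤∞ : ∀ {a b x y} → just a ≤∞ x → just b ≤∞ y → just (a ℤ.+ b) ≤∞ (x +∞ y)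
+∞-mono-≤∞ (fin≤fin p) (fin≤fin q) = fin≤fin (ℤ.+-mono-≤ p q)
+∞-mono-≤∞ (fin≤fin _) (_ ≤∞∞)     = _ ≤∞∞
+∞-mono-≤∞ (_ ≤∞∞)     _           = _ ≤∞∞

+∞-identityˡ : ∀ x → just (+ 0) +∞ x ≡ x
+∞-identityˡ (just a) = ≡.cong just (ℤ.+-identityˡ a)
+∞-identityˡ nothing  = refl

+∞-idempotent : ∀ x → ¬ x ≡ ∞ → x +∞ x ≡ x → x ≡ just (+ 0)
+∞-idempotent (just a) _   eq = ≡.cong just (i+i≡i⇒i≡0 a (just-injective eq))
+∞-idempotent nothing  x≢∞ _  = contradiction refl x≢∞

+∞-self-inverse : ∀ x → x +∞ x ≡ just (+ 0) → x ≡ just (+ 0)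
+∞-self-inverse (just a) eq = ≡.cong just (i+i≡0⇒i≡0 a (just-injective eq))

+∞-inverse-unique : ∀ a x → just a +∞ x ≡ just (+ 0) → x ≡ just (ℤ.- a)
+∞-inverse-unique a (just b) eq = ≡.cong just (ℤ-Group.inverseʳ-unique a b (just-injective eq))

minFin-≤ : ∀ {n} (g : Fin (suc n) → ℤ) k → minFin g ℤ.≤ g k
minFin-≤ {zero}  g zero    = ℤ.≤-refl
minFin-≤ {suc n} g zero    = ℤ.i⊓j≤i (g zero) _
minFin-≤ {suc n} g (suc k) = ℤ.≤-trans (ℤ.i⊓j≤j (g zero) _) (minFin-≤ (λ i → g (suc i)) k)

minFin-attained : ∀ {n} (g : Fin (suc n) → ℤ) → ∃ λ k → minFin g ≡ g k
minFin-attained {zero}  g = zero , refl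
minFin-attained {suc n} g with ℤ.⊓-sel (g zero) (minFin (λ i → g (suc i)))
... | inj₁ eq = zero , eq
... | inj₂ eq with minFin-attained (λ i → g (suc i))
...   | k , eq′ = suc k , ≡.trans eq eq′

module MatrixUnits {c ℓ} (R : CommutativeRing c ℓ) where
  open CommutativeRing R hiding (zero) renaming (refl to ≈-refl)
  open MatOver R

  δ : ∀ {a} {A : Set a} → Dec A → Carrier → Carrier
  δ (yes _) x = x
  δ (no _)  _ = 0#

  δ-yes : ∀ {a} {A : Set a} (d : Dec A) x → A → δ d x ≈ x
  δ-yes (yes _) x _ = ≈-refl
  δ-yes (no ¬a) x a = contradiction a ¬a

  δ-no : ∀ {a} {A : Set a} (d : Dec A) x → ¬ A → δ d x ≈ 0#
  δ-no (yes a) x ¬a = contradiction a ¬a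
  δ-no (no _)  x _  = ≈-refl

  δ-zero : ∀ {a} {A : Set a} (d : Dec A) → δ d 0# ≈ 0#
  δ-zero (yes _) = ≈-refl
  δ-zero (no _)  = ≈-refl

  δ-cong : ∀ {a} {A : Set a} (d : Dec A) {x y} → x ≈ y → δ d x ≈ δ d y
  δ-cong (yes _) x≈y = x≈y
  δ-cong (no _)  _   = ≈-refl

  δ-*ˡ : ∀ {a} {A : Set a} (d : Dec A) x y → δ d x * y ≈ δ d (x * y)
  δ-*ˡ (yes _) x y = ≈-refl
  δ-*ˡ (no _)  x y = zeroˡ y

  δ-*ʳ : ∀ {a} {A : Set a} (d : Dec A) x y → x * δ d y ≈ δ d (x * y)
  δ-*ʳ (yes _) x y = ≈-refl
  δ-*ʳ (no _)  x y = zeroʳ x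

  unit : ∀ {d} → Fin d → Fin d → Carrier → Mat d
  unit i j x r s = δ (r ≟ i) (δ (s ≟ j) x)

  unit-cong : ∀ {d} (i j : Fin d) {x y} → x ≈ y → unit i j x ≈ₘ unit i j y
  unit-cong i j x≈y r s = δ-cong (r ≟ i) (δ-cong (s ≟ j) x≈y)

  Σ-zero : ∀ {d} (f : Fin d → Carrier) → (∀ k → f k ≈ 0#) → Σ[ f ] ≈ 0#
  Σ-zero {zero}  f f≈0 = ≈-refl
  Σ-zero {suc d} f f≈0 =
    trans (+-cong (f≈0 zero) (Σ-zero (λ i → f (suc i)) (λ k → f≈0 (suc k)))) (+-identityʳ 0#)

  Σ-single : ∀ {d} (f : Fin d → Carrier) k → (∀ l → ¬ l ≡ k → f l ≈ 0#) → Σ[ f ] ≈ f k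
  Σ-single {suc d} f zero    f≈0 =
    trans (+-congˡ (Σ-zero (λ i → f (suc i)) (λ l → f≈0 (suc l) λ ()))) (+-identityʳ (f zero))
  Σ-single {suc d} f (suc k) f≈0 =
    trans (+-cong (f≈0 zero λ ())
                  (Σ-single (λ i → f (suc i)) k (λ l l≢k → f≈0 (suc l) (l≢k ∘ suc-injective))))
          (+-identityˡ (f (suc k)))

  unit-*ₘ : ∀ {d} (i k j : Fin d) a b → (unit i k a *ₘ unit k j b) ≈ₘ unit i j (a * b)
  unit-*ₘ i k j a b r s = trans (Σ-single _ k off-k) (begin
      δ (r ≟ i) (δ (k ≟ k) a) * δ (k ≟ k) (δ (s ≟ j) b)
        ≈⟨ *-cong (δ-cong (r ≟ i) (δ-yes (k ≟ k) a refl)) (δ-yes (k ≟ k) _ refl) ⟩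
      δ (r ≟ i) a * δ (s ≟ j) b        ≈⟨ δ-*ˡ (r ≟ i) a _ ⟩
      δ (r ≟ i) (a * δ (s ≟ j) b)      ≈⟨ δ-cong (r ≟ i) (δ-*ʳ (s ≟ j) a b) ⟩
      δ (r ≟ i) (δ (s ≟ j) (a * b))    ∎)
    where
      open ≈-Reasoning setoid
      off-k : ∀ l → ¬ l ≡ k → unit i k a r l * unit k j b l s ≈ 0#
      off-k l l≢k = trans (*-congʳ (trans (δ-cong (r ≟ i) (δ-no (l ≟ k) a l≢k)) (δ-zero (r ≟ i))))
                          (zeroˡ _)

  Σₘ : ∀ {m d} → (Fin m → Mat d) → Mat d
  Σₘ F r s = Σ[ (λ k → F k r s) ]

  unit-expansion : ∀ {d} (Z : Mat d) → Z ≈ₘ Σₘ (λ i → Σₘ (λ j → unit i j (Z i j)))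
  unit-expansion Z r s = sym (begin
      Σ[ (λ i → Σ[ (λ j → unit i j (Z i j) r s) ]) ]   ≈⟨ Σ-single _ r off-row ⟩
      Σ[ (λ j → unit r j (Z r j) r s) ]                ≈⟨ Σ-single _ s off-column ⟩
      δ (r ≟ r) (δ (s ≟ s) (Z r s))                    ≈⟨ δ-yes (r ≟ r) _ refl ⟩
      δ (s ≟ s) (Z r s)                                ≈⟨ δ-yes (s ≟ s) _ refl ⟩
      Z r s                                            ∎)
    where
      open ≈-Reasoning setoid
      off-row : ∀ i → ¬ i ≡ r → Σ[ (λ j → unit i j (Z i j) r s) ] ≈ 0#
      off-row i i≢r = Σ-zero _ (λ j → δ-no (r ≟ i) (δ (s ≟ j) (Z i j)) (i≢r ∘ ≡.sym))
      off-column : ∀ j → ¬ j ≡ s → unit r j (Z r j) r s ≈ 0#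
      off-column j j≢s = trans (δ-yes (r ≟ r) _ refl) (δ-no (s ≟ j) _ (j≢s ∘ ≡.sym))

module Valuation {c ℓ} (K : CommutativeRing c ℓ) (isField : IsField K)
    (val : CommutativeRing.Carrier K → ℤ∞) (isValuation : IsSurjDiscreteValuation K val) where
  open CommutativeRing K hiding (zero) renaming (refl to ≈-refl)
  open IsField isField
  open IsSurjDiscreteValuation isValuation
  open RingProperties ring using (-1*x≈-x; -‿involutive)
  open MatOver K
  open WithVal val
  open MatrixUnits K

  val-≈0 : ∀ {x} → x ≈ 0# → val x ≡ ∞
  val-≈0 = Equivalence.from (val-∞ _)

  val-just⇒≉0 : ∀ {x n} → val x ≡ just n → ¬ x ≈ 0#
  val-just⇒≉0 val-x x≈0 with ≡.trans (≡.sym val-x) (val-≈0 x≈0)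
  ... | ()

  ≤∞-val-0 : ∀ m → just m ≤∞ val 0#
  ≤∞-val-0 m = ≡.subst (just m ≤∞_) (≡.sym (val-≈0 ≈-refl)) (_ ≤∞∞)

  val-1 : val 1# ≡ just (+ 0)
  val-1 = +∞-idempotent (val 1#) (1≉0 ∘ Equivalence.to (val-∞ 1#))
                        (≡.trans (≡.sym (val-* 1# 1#)) (val-cong (*-identityˡ 1#)))

  val-sqrt-1 : ∀ {u} → u * u ≈ 1# → val u ≡ just (+ 0)
  val-sqrt-1 {u} u²≈1 = +∞-self-inverse (val u) (≡.trans (≡.sym (val-* u u)) (≡.trans (val-cong u²≈1) val-1))

  val-neg : ∀ x → val (- x) ≡ val x
  val-neg x = begin
      val (- x)               ≡⟨ val-cong (sym (-1*x≈-x x)) ⟩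
      val (- 1# * x)          ≡⟨ val-* (- 1#) x ⟩
      val (- 1#) +∞ val x     ≡⟨ ≡.cong (_+∞ val x) (val-sqrt-1 (trans (-1*x≈-x (- 1#)) (-‿involutive 1#))) ⟩
      just (+ 0) +∞ val x     ≡⟨ +∞-identityˡ (val x) ⟩
      val x                   ∎
    where open ≡.≡-Reasoning

  val-inverse : ∀ {a b n} → a * b ≈ 1# → val a ≡ just n → val b ≡ just (ℤ.- n)
  val-inverse {a} {b} {n} ab≈1 val-a = +∞-inverse-unique n (val b) (begin
      just n +∞ val b   ≡⟨ ≡.cong (_+∞ val b) val-a ⟨
      val a +∞ val b    ≡⟨ val-* a b ⟨
      val (a * b)       ≡⟨ val-cong ab≈1 ⟩
      val 1#            ≡⟨ val-1 ⟩
      just (+ 0)        ∎)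
    where open ≡.≡-Reasoning

  val-Σ : ∀ {d m} (f : Fin d → Carrier) → (∀ k → just m ≤∞ val (f k)) → just m ≤∞ val Σ[ f ]
  val-Σ {zero}  {m} f _   = ≤∞-val-0 m
  val-Σ {suc d}     f m≤f =
    ≤∞-trans (≤∞-min∞ (m≤f zero) (val-Σ (λ i → f (suc i)) (λ k → m≤f (suc k)))) (val-+ _ _)

  ∈I-resp-≈ₘ : ∀ {d} {L : IMat d} {Z W : Mat d} → Z ≈ₘ W → W ∈I L → Z ∈I L
  ∈I-resp-≈ₘ Z≈W W∈I i j = ≡.subst (just _ ≤∞_) (≡.sym (val-cong (Z≈W i j))) (W∈I i j)

  0ₘ-∈I : ∀ {d} (L : IMat d) → 0ₘ ∈I L
  0ₘ-∈I L i j = ≤∞-val-0 (L i j)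

  +ₘ-∈I : ∀ {d} {L : IMat d} {A B : Mat d} → A ∈I L → B ∈I L → (A +ₘ B) ∈I L
  +ₘ-∈I A∈I B∈I i j = ≤∞-trans (≤∞-min∞ (A∈I i j) (B∈I i j)) (val-+ _ _)

  -ₘ-∈I : ∀ {d} {L : IMat d} {A : Mat d} → A ∈I L → (-ₘ A) ∈I L
  -ₘ-∈I {A = A} A∈I i j = ≡.subst (just _ ≤∞_) (≡.sym (val-neg (A i j))) (A∈I i j)

  *ₘ-∈I-⊙ : ∀ {n} {N N′ : IMat (suc n)} {X Y : Mat (suc n)} →
            X ∈I N → Y ∈I N′ → (X *ₘ Y) ∈I (N ⊙ N′)
  *ₘ-∈I-⊙ {N = N} {N′} {X} {Y} X∈I Y∈I i j = val-Σ _ λ k →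
    ≤∞-trans (fin≤fin (minFin-≤ (λ k → N i k ℤ.+ N′ k j) k))
             (≡.subst (just _ ≤∞_) (≡.sym (val-* (X i k) (Y k j))) (+∞-mono-≤∞ (X∈I i k) (Y∈I k j)))

  ·I⊆I-⊙ : ∀ {n} {N N′ : IMat (suc n)} {Z : Mat (suc n)} → Z ∈I N ·I N′ → Z ∈I (N ⊙ N′)
  ·I⊆I-⊙ (gen X Y X∈I Y∈I Z≈XY) = ∈I-resp-≈ₘ Z≈XY (*ₘ-∈I-⊙ X∈I Y∈I)
  ·I⊆I-⊙ (zro Z≈0)              = ∈I-resp-≈ₘ Z≈0 (0ₘ-∈I _)
  ·I⊆I-⊙ (add A B A∈ B∈ Z≈A+B)  = ∈I-resp-≈ₘ Z≈A+B (+ₘ-∈I (·I⊆I-⊙ A∈) (·I⊆I-⊙ B∈))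
  ·I⊆I-⊙ (neg A A∈ Z≈-A)        = ∈I-resp-≈ₘ Z≈-A (-ₘ-∈I (·I⊆I-⊙ A∈))

  unit-∈I : ∀ {d} (L : IMat d) i j x → just (L i j) ≤∞ val x → unit i j x ∈I L
  unit-∈I L i j x L≤x r s = bound (r ≟ i) (s ≟ j)
    where
      bound : (r≟i : Dec (r ≡ i)) (s≟j : Dec (s ≡ j)) → just (L r s) ≤∞ val (δ r≟i (δ s≟j x))
      bound (yes refl) (yes refl) = L≤x
      bound (yes refl) (no _)     = ≤∞-val-0 (L r s)
      bound (no _)     _          = ≤∞-val-0 (L r s)

  ∈·I-resp-≈ₘ : ∀ {d} {N N′ : IMat d} {Z W : Mat d} → Z ≈ₘ W → W ∈I N ·I N′ → Z ∈I N ·I N′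
  ∈·I-resp-≈ₘ Z≈W (gen X Y X∈I Y∈I W≈XY) = gen X Y X∈I Y∈I (λ i j → trans (Z≈W i j) (W≈XY i j))
  ∈·I-resp-≈ₘ Z≈W (zro W≈0)              = zro (λ i j → trans (Z≈W i j) (W≈0 i j))
  ∈·I-resp-≈ₘ Z≈W (add A B A∈ B∈ W≈A+B)  = add A B A∈ B∈ (λ i j → trans (Z≈W i j) (W≈A+B i j))
  ∈·I-resp-≈ₘ Z≈W (neg A A∈ W≈-A)        = neg A A∈ (λ i j → trans (Z≈W i j) (W≈-A i j))

  Σₘ-∈·I : ∀ {m d} {N N′ : IMat d} (F : Fin m → Mat d) → (∀ k → F k ∈I N ·I N′) → Σₘ F ∈I N ·I N′
  Σₘ-∈·I {zero}  F _   = zro (λ _ _ → ≈-refl)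
  Σₘ-∈·I {suc m} F F∈ =
    add (F zero) (Σₘ (λ k → F (suc k))) (F∈ zero) (Σₘ-∈·I (λ k → F (suc k)) (λ k → F∈ (suc k)))
        (λ _ _ → ≈-refl)

  unit-∈·I : ∀ {n} (N N′ : IMat (suc n)) i j x → just ((N ⊙ N′) i j) ≤∞ val x →
             unit i j x ∈I N ·I N′
  unit-∈·I N N′ i j x ⊙≤x with minFin-attained (λ k → N i k ℤ.+ N′ k j)
  ... | k , ⊙≡ with val-surj (N i k)
  ... | a , val-a with inverse a (val-just⇒≉0 val-a)
  ... | b , ab≈1 =
    gen (unit i k a) (unit k j (b * x))
        (unit-∈I N i k a (≡.subst (just (N i k) ≤∞_) (≡.sym val-a) (fin≤fin ℤ.≤-refl)))
        (unit-∈I N′ k j (b * x) N′≤bx)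
        (λ r s → sym (trans (unit-*ₘ i k j a (b * x) r s) (unit-cong i j a[bx]≈x r s)))
    where
      a[bx]≈x : a * (b * x) ≈ x
      a[bx]≈x = trans (sym (*-assoc a b x)) (trans (*-congʳ ab≈1) (*-identityˡ x))
      val-bx : val (b * x) ≡ just (ℤ.- N i k) +∞ val x
      val-bx = ≡.trans (val-* b x) (≡.cong (_+∞ val x) (val-inverse ab≈1 val-a))
      N′≤bx : just (N′ k j) ≤∞ val (b * x)
      N′≤bx = ≡.subst₂ _≤∞_ (≡.cong just (ℤ-Group.\\-leftDividesʳ (N i k) (N′ k j))) (≡.sym val-bx)
                (+∞-mono-≤∞ (fin≤fin ℤ.≤-refl) (≡.subst (λ t → just t ≤∞ val x) ⊙≡ ⊙≤x))

  I-⊙⊆·I : ∀ {n} (N N′ : IMat (suc n)) (Z : Mat (suc n)) → Z ∈I (N ⊙ N′) → Z ∈I N ·I N′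
  I-⊙⊆·I N N′ Z Z∈I = ∈·I-resp-≈ₘ (unit-expansion Z)
    (Σₘ-∈·I _ λ i → Σₘ-∈·I _ λ j → unit-∈·I N N′ i j (Z i j) (Z∈I i j))

proposition5p5 : ∀ {c ℓ} (K : CommutativeRing c ℓ) → IsField K →
    (val : CommutativeRing.Carrier K → ℤ∞) → IsSurjDiscreteValuation K val →
    (p : CommutativeRing.Carrier K) → val p ≡ just (+ 1) →
    (n : ℕ) (M N N′ : IMat (suc n)) →
    IsOrderMatrix M → IsCompatible M N → IsCompatible M N′ →
    let open MatOver K in let open WithVal val in
    ∀ (Z : Mat (suc n)) → (Z ∈I N ·I N′) ⇔ (Z ∈I (N ⊙ N′))
proposition5p5 K isField val isValuation _ _ _ _ N N′ _ _ _ Z =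
  mk⇔ ·I⊆I-⊙ (I-⊙⊆·I N N′ Z)
  where open Valuation K isField val isValuation
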